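{- Let $m\ge1$, $t,\lambda\ge1$, and let $\mathbf{v}=(v_1,\ldots,v_m)$, $\mathbf{k}=(k_1,\ldots,k_m)$ be $m$-tuples of positive integers with $\mathbf{v}\ge\mathbf{k}$ componentwise and $\sum_ik_i\ge t$. Suppose there is $i\in\{1,\ldots,m\}$ with $D_\lambda(\mathbf{v},\mathbf{k},t)=D_\lambda(v_i,k_i,t)$. For $j\ne i$ let $v_j'\ge v_j$ be integers, and let $\mathbf{v}'=(v_1',\ldots,v_{i-1}',v_i,v_{i+1}',\ldots,v_m')$. Then $D_\lambda(\mathbf{v}',\mathbf{k},t)=D_\lambda(v_i,k_i,t)$.
   Context: Let $X_1,\ldots,X_m$ be pairwise disjoint sets with $|X_i|=v_i$. A block is an $m$-tuple $(B_1,\ldots,B_m)$ with $B_i\subseteq X_i$ and $|B_i|=k_i$. An $m$-tuple $(T_1,\ldots,T_m)$ is admissible if $T_i\subseteq X_i$, $|T_i|\le k_i$ for all $i$, and $\sum_i|T_i|=t$; it is contained in a block if $T_i\subseteq B_i$ for all $i$. A $t$-$(\mathbf{v},\mathbf{k},\lambda)$ generalized packing is a family of blocks such that every admissible $m$-tuple is contained in at most $\lambda$ blocks. $D_\lambda(\mathbf{v},\mathbf{k},t)$ is the maximum number of blocks in such a generalized packing. For integers $v\ge k\ge t$, $D_\lambda(v,k,t)$ is the maximum number of $k$-subsets of a $v$-set such that every $t$-subset lies in at most $\lambda$ of them. -}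

module Defs where

open import Data.Nat using (ℕ; _≤_)
open import Data.Fin using (Fin)
open import Data.Fin.Subset using (Subset; _⊆_; ∣_∣)
open import Data.Fin.Subset.Properties using (_⊆?_)
open import Data.Fin.Properties using (all?)
open import Data.Vec using (tabulate)
open import Data.Vec as Vec using ()
open import Data.List using (List; length; filter)
open import Data.Product using (Σ; Σ-syntax; _×_; proj₁)
open import Relation.Binary.PropositionalEquality using (_≡_)

-- Generalized packings.  X_i is modelled as Fin (v i); a family of
-- blocks is a List (a multiset: repeated blocks allowed).

Block : (m : ℕ) → (v k : Fin m → ℕ) → Set
Block m v k = Σ[ B ∈ ((i : Fin m) → Subset (v i)) ] ((i : Fin m) → ∣ B i ∣ ≡ k i)

Tuple : (m : ℕ) → (v : Fin m → ℕ) → Set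
Tuple m v = (i : Fin m) → Subset (v i)

totalSize : {m : ℕ} {v : Fin m → ℕ} → Tuple m v → ℕ
totalSize {m} T = Vec.sum (tabulate (λ i → ∣ T i ∣))

Admissible : {m : ℕ} (v k : Fin m → ℕ) (t : ℕ) → Tuple m v → Set
Admissible v k t T = ((i : _) → ∣ T i ∣ ≤ k i) × totalSize T ≡ t

_containedIn_ : {m : ℕ} {v k : Fin m → ℕ} → Tuple m v → Block m v k → Set
T containedIn B = (i : _) → T i ⊆ proj₁ B i

countContaining : {m : ℕ} {v k : Fin m → ℕ} → Tuple m v → List (Block m v k) → ℕ
countContaining T F = length (filter (λ B → all? (λ i → T i ⊆? proj₁ B i)) F)

IsGenPacking : {m : ℕ} (v k : Fin m → ℕ) (t lam : ℕ) → List (Block m v k) → Set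
IsGenPacking {m} v k t lam F =
  (T : Tuple m v) → Admissible v k t T → countContaining T F ≤ lam

IsGenD : {m : ℕ} (lam : ℕ) (v k : Fin m → ℕ) (t : ℕ) → ℕ → Set
IsGenD {m} lam v k t n =
  (Σ[ F ∈ List (Block m v k) ] (IsGenPacking v k t lam F × length F ≡ n))
  × ((F : List (Block m v k)) → IsGenPacking v k t lam F → length F ≤ n)

KSubset : (v k : ℕ) → Set
KSubset v k = Σ[ B ∈ Subset v ] ∣ B ∣ ≡ k

countContaining₁ : {v k : ℕ} → Subset v → List (KSubset v k) → ℕ
countContaining₁ T F = length (filter (λ B → T ⊆? proj₁ B) F)

IsPacking : (v k t lam : ℕ) → List (KSubset v k) → Set
IsPacking v k t lam F =
  (T : Subset v) → ∣ T ∣ ≡ t → countContaining₁ T F ≤ lam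

IsD : (lam v k t : ℕ) → ℕ → Set
IsD lam v k t n =
  (Σ[ F ∈ List (KSubset v k) ] (IsPacking v k t lam F × length F ≡ n))
  × ((F : List (KSubset v k)) → IsPacking v k t lam F → length F ≤ n)

module Submission where

-- Write n for the common value and v' for the enlarged sizes.  Two
-- facts about generalized packings, valid for arbitrary sizes, give
-- the two inequalities of D_λ(v',k,t) = n.
--
--  * Enlarging (packing-enlarge).  If v ≤ v' componentwise, a packing
--    on v stays a packing on v' once each X_j is embedded into the
--    larger X'_j: an admissible tuple meeting a new point lies in no
--    embedded block, and any other one is an admissible tuple of the
--    old packing.  Hence the optimal packing on v gives one of size n.
--  * Projecting (packing-project).  Keeping only the i-th component of
--    each block turns a generalized packing into an ordinary t-packing
--    of k_i-subsets of X_i: a t-subset T of X_i, put in coordinate i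
--    with empty sets elsewhere, is admissible (or lies in no block when
--    t > k_i).  Hence every packing on v' has at most D_λ(v_i,k_i,t) = n
--    blocks.

open import Defs
open import Level using (0ℓ)
open import Data.Nat using (ℕ; _≤_; _≥_; z≤n; s≤s; zero; suc)
open import Data.Nat.Properties
  using (≤-trans; ≤-reflexive; n≤0⇒n≡0; +-identityʳ; m≤n⇒m≤1+n; _≤?_)
import Data.Nat.Properties as ℕ
open import Data.Fin using (Fin; zero; suc; _≟_)
open import Data.Fin.Properties using (all?; suc-injective)
open import Data.Fin.Subset using (Subset; _⊆_; ∣_∣; ⊥; inside; outside)
open import Data.Fin.Subset.Properties using (_⊆?_; drop-∷-⊆; p⊆q⇒∣p∣≤∣q∣; ∣⊥∣≡0; ⊥⊆)
open import Data.Vec using (tabulate; sum; []; _∷_)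
open import Data.Vec.Properties using (tabulate-cong)
open import Data.Vec.Base using (here; there)
open import Data.List using (List; length; filter; map; []; _∷_)
open import Data.List.Properties using (length-map; filter-none)
open import Data.List.Relation.Unary.All using (universal)
open import Data.List.Relation.Unary.All.Properties using (map⁺)
open import Data.Product using (proj₁; proj₂; _,_)
open import Data.Empty using (⊥-elim)
open import Relation.Nullary using (yes; no; ¬_)
open import Relation.Unary using (Pred; Decidable)
open import Relation.Binary.PropositionalEquality
  using (_≡_; _≢_; refl; sym; trans; cong; subst)

module _ {A B : Set} {P : Pred A 0ℓ} (P? : Decidable P) (f : B → A) where

  count-map-≤ : {Q : Pred B 0ℓ} (Q? : Decidable Q) → (∀ x → P (f x) → Q x) →
                ∀ xs → length (filter P? (map f xs)) ≤ length (filter Q? xs)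
  count-map-≤ Q? P⇒Q [] = z≤n
  count-map-≤ Q? P⇒Q (x ∷ xs) with P? (f x) | Q? x
  ... | yes p | yes _ = s≤s (count-map-≤ Q? P⇒Q xs)
  ... | yes p | no ¬q = ⊥-elim (¬q (P⇒Q x p))
  ... | no _  | yes _ = m≤n⇒m≤1+n (count-map-≤ Q? P⇒Q xs)
  ... | no _  | no _  = count-map-≤ Q? P⇒Q xs

  count-map-none : (∀ x → ¬ P (f x)) → ∀ xs → length (filter P? (map f xs)) ≤ 0
  count-map-none ¬P xs = ≤-reflexive (cong length (filter-none P? (map⁺ (universal ¬P xs))))

embed : ∀ {a b} → a ≤ b → Subset a → Subset b
embed {b = b} z≤n [] = ⊥ {b}
embed (s≤s a≤b) (x ∷ xs) = x ∷ embed a≤b xs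

restrict : ∀ {a b} → a ≤ b → Subset b → Subset a
restrict z≤n _ = []
restrict (s≤s a≤b) (x ∷ xs) = x ∷ restrict a≤b xs

∣embed∣ : ∀ {a b} (a≤b : a ≤ b) (B : Subset a) → ∣ embed a≤b B ∣ ≡ ∣ B ∣
∣embed∣ {b = b} z≤n [] = ∣⊥∣≡0 b
∣embed∣ (s≤s a≤b) (inside ∷ B) = cong suc (∣embed∣ a≤b B)
∣embed∣ (s≤s a≤b) (outside ∷ B) = ∣embed∣ a≤b B

∣restrict∣≤ : ∀ {a b} (a≤b : a ≤ b) (T : Subset b) → ∣ restrict a≤b T ∣ ≤ ∣ T ∣
∣restrict∣≤ z≤n T = z≤n
∣restrict∣≤ (s≤s a≤b) (inside ∷ T) = s≤s (∣restrict∣≤ a≤b T)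
∣restrict∣≤ (s≤s a≤b) (outside ∷ T) = ∣restrict∣≤ a≤b T

restrict-⊆ : ∀ {a b} (a≤b : a ≤ b) (T : Subset b) (B : Subset a) →
             T ⊆ embed a≤b B → restrict a≤b T ⊆ B
restrict-⊆ z≤n T [] T⊆B {()}
restrict-⊆ (s≤s a≤b) (x ∷ T) (inside ∷ B) T⊆B {zero} here = here
restrict-⊆ (s≤s a≤b) (x ∷ T) (outside ∷ B) T⊆B {zero} here with T⊆B here
... | ()
restrict-⊆ (s≤s a≤b) (x ∷ T) (_ ∷ B) T⊆B {suc _} (there y∈T) =
  there (restrict-⊆ a≤b T B (drop-∷-⊆ T⊆B) y∈T)

-- A subset of an embedded set avoids the new points, so restricting it
-- loses nothing.
∣restrict∣-⊆ : ∀ {a b} (a≤b : a ≤ b) (T : Subset b) (B : Subset a) →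
               T ⊆ embed a≤b B → ∣ restrict a≤b T ∣ ≡ ∣ T ∣
∣restrict∣-⊆ {b = b} z≤n T [] T⊆B =
  sym (n≤0⇒n≡0 (≤-trans (p⊆q⇒∣p∣≤∣q∣ T⊆B) (≤-reflexive (∣⊥∣≡0 b))))
∣restrict∣-⊆ (s≤s a≤b) (inside ∷ T) (_ ∷ B) T⊆B = cong suc (∣restrict∣-⊆ a≤b T B (drop-∷-⊆ T⊆B))
∣restrict∣-⊆ (s≤s a≤b) (outside ∷ T) (_ ∷ B) T⊆B = ∣restrict∣-⊆ a≤b T B (drop-∷-⊆ T⊆B)

sum-zero : ∀ {m} (f : Fin m → ℕ) → (∀ j → f j ≡ 0) → sum (tabulate f) ≡ 0
sum-zero {zero} f f≡0 = refl
sum-zero {suc m} f f≡0 rewrite f≡0 zero = sum-zero (λ j → f (suc j)) (λ j → f≡0 (suc j))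

sum-single : ∀ {m} (f : Fin m → ℕ) (i : Fin m) → (∀ j → j ≢ i → f j ≡ 0) →
             sum (tabulate f) ≡ f i
sum-single {suc m} f zero off
  rewrite sum-zero (λ j → f (suc j)) (λ j → off (suc j) (λ ())) = +-identityʳ (f zero)
sum-single {suc m} f (suc i) off rewrite off zero (λ ()) =
  sum-single (λ j → f (suc j)) i (λ j j≢i → off (suc j) (λ e → j≢i (suc-injective e)))

single : ∀ {m} {v : Fin m → ℕ} (i : Fin m) → Subset (v i) → Tuple m v
single {v = v} i T j with j ≟ i
... | yes refl = T
... | no _ = ⊥ {v j}

module _ {m : ℕ} {v : Fin m → ℕ} (i : Fin m) (T : Subset (v i)) where

  ∣single∣-on : ∣ single {v = v} i T i ∣ ≡ ∣ T ∣
  ∣single∣-on with i ≟ i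
  ... | yes refl = refl
  ... | no i≢i = ⊥-elim (i≢i refl)

  ∣single∣-off : ∀ j → j ≢ i → ∣ single {v = v} i T j ∣ ≡ 0
  ∣single∣-off j j≢i with j ≟ i
  ... | yes j≡i = ⊥-elim (j≢i j≡i)
  ... | no _ = ∣⊥∣≡0 (v j)

  ∣single∣≤ : (k : Fin m → ℕ) → ∣ T ∣ ≤ k i → ∀ j → ∣ single {v = v} i T j ∣ ≤ k j
  ∣single∣≤ k ∣T∣≤kᵢ j with j ≟ i
  ... | yes refl = ∣T∣≤kᵢ
  ... | no _ = subst (_≤ k j) (sym (∣⊥∣≡0 (v j))) z≤n

  totalSize-single : totalSize (single {v = v} i T) ≡ ∣ T ∣
  totalSize-single = trans (sum-single _ i ∣single∣-off) ∣single∣-on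

  single-⊆ : (B : Tuple m v) → T ⊆ B i → ∀ j → single {v = v} i T j ⊆ B j
  single-⊆ B T⊆Bi j with j ≟ i
  ... | yes refl = T⊆Bi
  ... | no _ = ⊥⊆

-- The decision procedure that countContaining uses to test T ⊆ B.
inBlock? : ∀ {m} {v k : Fin m → ℕ} (T : Tuple m v) → Decidable (λ (B : Block m v k) → T containedIn B)
inBlock? T B = all? (λ j → T j ⊆? proj₁ B j)

module _ {m : ℕ} {v v' k : Fin m → ℕ} (v≤v' : ∀ j → v j ≤ v' j) where

  embedBlock : Block m v k → Block m v' k
  embedBlock B = (λ j → embed (v≤v' j) (proj₁ B j)) ,
                 (λ j → trans (∣embed∣ (v≤v' j) (proj₁ B j)) (proj₂ B j))

  restrictTuple : Tuple m v' → Tuple m v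
  restrictTuple T' j = restrict (v≤v' j) (T' j)

  -- If restricting T' loses a point, T' meets a new point and lies in
  -- no embedded block; otherwise its restriction is admissible for the
  -- original packing and lies in B whenever T' lies in embedBlock B.
  packing-enlarge : ∀ {t lam} F → IsGenPacking v k t lam F →
                    IsGenPacking v' k t lam (map embedBlock F)
  packing-enlarge F pack T' (small , total)
    with all? (λ j → ∣ restrictTuple T' j ∣ ℕ.≟ ∣ T' j ∣)
  ... | yes keeps = ≤-trans
    (count-map-≤ (inBlock? T') embedBlock (inBlock? (restrictTuple T'))
       (λ B T'⊆B j → restrict-⊆ (v≤v' j) (T' j) (proj₁ B j) (T'⊆B j)) F)
    (pack (restrictTuple T')
       ( (λ j → ≤-trans (∣restrict∣≤ (v≤v' j) (T' j)) (small j))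
       , trans (cong sum (tabulate-cong keeps)) total))
  ... | no loses = ≤-trans
    (count-map-none (inBlock? T') embedBlock
       (λ B T'⊆B → loses (λ j → ∣restrict∣-⊆ (v≤v' j) (T' j) (proj₁ B j) (T'⊆B j))) F)
    z≤n

module _ {m : ℕ} {v k : Fin m → ℕ} (i : Fin m) where

  projectBlock : Block m v k → KSubset (v i) (k i)
  projectBlock B = proj₁ B i , proj₂ B i

  -- A t-subset T of X_i with t ≤ k_i is tested through the admissible
  -- tuple single i T; if t > k_i, T lies in no k_i-subset at all.
  packing-project : ∀ {t lam} F → IsGenPacking v k t lam F →
                    IsPacking (v i) (k i) t lam (map projectBlock F)
  packing-project {t} F pack T ∣T∣≡t with t ≤? k i
  ... | no t≰kᵢ = ≤-trans
    (count-map-none (λ B → T ⊆? proj₁ B) projectBlock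
       (λ B T⊆Bᵢ → t≰kᵢ (subst (_≤ k i) ∣T∣≡t
                          (≤-trans (p⊆q⇒∣p∣≤∣q∣ T⊆Bᵢ) (≤-reflexive (proj₂ B i))))) F)
    z≤n
  ... | yes t≤kᵢ = ≤-trans
    (count-map-≤ (λ B → T ⊆? proj₁ B) projectBlock (inBlock? Tᵢ)
       (λ B → single-⊆ i T (proj₁ B)) F)
    (pack Tᵢ (∣single∣≤ i T k (subst (_≤ k i) (sym ∣T∣≡t) t≤kᵢ) ,
              trans (totalSize-single i T) ∣T∣≡t))
    where
    Tᵢ : Tuple m v
    Tᵢ = single i T

proposition3p2 : (m t lam : ℕ) → m ≥ 1 → t ≥ 1 → lam ≥ 1
    → (v k : Fin m → ℕ)
    → ((j : Fin m) → k j ≥ 1) → ((j : Fin m) → v j ≥ 1)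
    → ((j : Fin m) → k j ≤ v j)
    → sum (tabulate k) ≥ t
    → (i : Fin m) → (n : ℕ)
    → IsGenD lam v k t n → IsD lam (v i) (k i) t n
    → (v' : Fin m → ℕ) → v' i ≡ v i → ((j : Fin m) → j ≢ i → v j ≤ v' j)
    → IsGenD lam v' k t n
proposition3p2 m t lam _ _ _ v k _ _ _ _ i n ((F , pack , ∣F∣≡n) , _) Dᵢ v' v'ᵢ≡vᵢ v≤v'-off =
  (map (embedBlock v≤v') F , packing-enlarge v≤v' F pack , trans (length-map _ F) ∣F∣≡n) ,
  atMost
  where
  v≤v' : ∀ j → v j ≤ v' j
  v≤v' j with j ≟ i
  ... | yes refl = ≤-reflexive (sym v'ᵢ≡vᵢ)
  ... | no j≢i = v≤v'-off j j≢i

  D'ᵢ : IsD lam (v' i) (k i) t n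
  D'ᵢ = subst (λ w → IsD lam w (k i) t n) (sym v'ᵢ≡vᵢ) Dᵢ

  atMost : (F' : List (Block m v' k)) → IsGenPacking v' k t lam F' → length F' ≤ n
  atMost F' pack' = subst (_≤ n) (length-map (projectBlock i) F')
                          (proj₂ D'ᵢ (map (projectBlock i) F') (packing-project i F' pack'))
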